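{- For any tree $T$ of order $n\ge 2$, $i_{\{R2\}}(T)\ge i(T)+1$.
   Context: $i(T)$ is the independent domination number: the minimum cardinality of a set that is both independent and dominating in $T$. A Roman $\{2\}$-dominating function on a graph $G=(V,E)$ is a function $g:V\to\{0,1,2\}$ such that every $v$ with $g(v)=0$ satisfies $\sum_{u\in N(v)}g(u)\ge 2$; it is independent if $\{v:g(v)>0\}$ is an independent set. $i_{\{R2\}}(G)$ is the minimum weight $\sum_v g(v)$ of an independent Roman $\{2\}$-dominating function on $G$. -}

module Defs where

open import Data.Nat using (ℕ; zero; suc; _+_; _≤_; _<_)
open import Data.Nat.ListAction using (sum)
open import Data.Bool using (Bool; true; false; T; if_then_else_)
open import Data.Fin using (Fin)
open import Data.Fin.Subset using (Subset; _∈_; ∣_∣)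
open import Data.List using (List; []; _∷_; map; allFin; length)
open import Data.List.Relation.Unary.Unique.Propositional using (Unique)
open import Data.Product using (Σ; _×_; ∃; ∃-syntax)
open import Relation.Binary.PropositionalEquality using (_≡_)
open import Relation.Nullary using (¬_)

record Graph (n : ℕ) : Set where
  field
    adj   : Fin n → Fin n → Bool
    sym   : ∀ u v → adj u v ≡ adj v u
    irrefl : ∀ v → adj v v ≡ false

open Graph public

Adj : ∀ {n} → Graph n → Fin n → Fin n → Set
Adj G u v = T (adj G u v)

data Walk {n : ℕ} (G : Graph n) : Fin n → List (Fin n) → Fin n → Set where
  stop : ∀ {x} → Walk G x [] x
  step : ∀ {x y z ys} → Adj G x y → Walk G y ys z → Walk G x (y ∷ ys) z

Connected : ∀ {n} → Graph n → Set
Connected G = ∀ u v → ∃[ vs ] Walk G u vs v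

-- A cycle: distinct vertices x, v1, ..., vk (k ≥ 2), consecutive ones adjacent,
-- and vk adjacent to x.
HasCycle : ∀ {n} → Graph n → Set
HasCycle {n} G =
  Σ (Fin n) λ x → Σ (List (Fin n)) λ vs → Σ (Fin n) λ y →
    Walk G x vs y × Unique (x ∷ vs) × 2 ≤ length vs × Adj G y x

IsTree : ∀ {n} → Graph n → Set
IsTree G = Connected G × ¬ HasCycle G

Independent : ∀ {n} → Graph n → Subset n → Set
Independent G S = ∀ u v → u ∈ S → v ∈ S → ¬ Adj G u v

Dominating : ∀ {n} → Graph n → Subset n → Set
Dominating G S = ∀ v → ¬ (v ∈ S) → ∃[ u ] (u ∈ S × Adj G u v)

IndependentDominating : ∀ {n} → Graph n → Subset n → Set
IndependentDominating G S = Independent G S × Dominating G S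

IsIndepDomNumber : ∀ {n} → Graph n → ℕ → Set
IsIndepDomNumber G k =
  (∃[ S ] (IndependentDominating G S × ∣ S ∣ ≡ k)) ×
  (∀ S → IndependentDominating G S → k ≤ ∣ S ∣)

sumV : ∀ {n} → (Fin n → ℕ) → ℕ
sumV {n} f = sum (map f (allFin n))

nbrSum : ∀ {n} → Graph n → (Fin n → ℕ) → Fin n → ℕ
nbrSum G g v = sumV (λ u → if adj G u v then g u else 0)

weight : ∀ {n} → (Fin n → ℕ) → ℕ
weight g = sumV g

IsIndepRoman2DF : ∀ {n} → Graph n → (Fin n → ℕ) → Set
IsIndepRoman2DF G g =
  (∀ v → g v ≤ 2) ×
  (∀ v → g v ≡ 0 → 2 ≤ nbrSum G g v) ×
  (∀ u v → 0 < g u → 0 < g v → ¬ Adj G u v)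

IsIndepRoman2Number : ∀ {n} → Graph n → ℕ → Set
IsIndepRoman2Number G k =
  (∃[ g ] (IsIndepRoman2DF G g × weight g ≡ k)) ×
  (∀ g → IsIndepRoman2DF G g → k ≤ weight g)

module Submission where

-- Since i(T) is a lower bound for the size of every independent dominating
-- set, it suffices to build, from any independent Roman {2}-dominating
-- function g, an independent dominating set X with |X| + 1 ≤ w(g).
--  (A) If some vertex has g v ≥ 2, take X = supp g.  It is independent by
--      assumption and dominating because a vertex of value 0 has a neighbour
--      of positive value; the vertex of value ≥ 2 gives |supp g| < w(g).
--      This works in every graph.
--  (B) If g only takes the values 0 and 1, pick w with g w = 0 (an end of an
--      edge, by independence) and X = {w} ∪ {v : g v = 1, v ∉ N(w)}.  A vertex
--      x ∉ X outside N(w) has two distinct neighbours u₁, u₂ of value 1; if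
--      both were in N(w), then w u₁ x u₂ would be a 4-cycle.  As N(w) carries
--      weight ≥ 2, |X| ≤ 1 + (w(g) − 2).

open import Defs
open import Data.Nat using (ℕ; zero; suc; _+_; _≤_; _<_; z≤n; s≤s)
open import Data.Nat.Properties
  using (≤-refl; ≤-reflexive; ≤-trans; ≤-pred; +-mono-≤; +-mono-<-≤; +-mono-≤-<;
         +-comm; +-identityʳ; m≤m+n; m≤n+m; n≤0⇒n≡0; ≮⇒≥; ≰⇒>; _<?_; _≤?_;
         +-commutativeSemigroup; module ≤-Reasoning)
open import Algebra.Properties.CommutativeSemigroup +-commutativeSemigroup using (interchange)
open import Data.Nat.ListAction using (sum)
open import Data.Bool using (Bool; true; false; T; if_then_else_)
open import Data.Fin using (Fin; zero; suc)
open import Data.Fin.Properties using (any?; suc-injective; _≟_)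
open import Data.Fin.Subset using (Subset; _∈_; ∣_∣)
open import Data.Vec using (tabulate)
open import Data.Vec.Properties using (lookup∘tabulate; []=⇒lookup; lookup⇒[]=)
open import Data.List using ([]; _∷_) renaming (tabulate to tabulateᴸ)
open import Data.List.Properties using (map-tabulate)
open import Data.List.Relation.Unary.Unique.Propositional using (Unique)
open import Data.List.Relation.Unary.All using ([]; _∷_)
open import Data.List.Relation.Unary.AllPairs using ([]; _∷_)
open import Data.Product using (_×_; _,_; proj₁; proj₂; ∃-syntax; ∃₂)
open import Data.Sum using (_⊎_; inj₁; inj₂)
open import Data.Empty using (⊥; ⊥-elim)
open import Data.Unit using (tt)
open import Function using (_∘_; id)
open import Level using (0ℓ)
open import Relation.Unary using (Pred; Decidable)
open import Relation.Nullary using (¬_; Dec; yes; no; does)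
open import Relation.Nullary.Decidable using (dec-true; dec-false; T?; ¬?; _×-dec_; _⊎-dec_)
open import Relation.Binary.PropositionalEquality
  using (_≡_; _≢_; refl; cong; trans; subst; ≢-sym) renaming (sym to ≡-sym)

𝟙 : Bool → ℕ
𝟙 b = if b then 1 else 0

sumV-tabulate : ∀ {n} (f : Fin n → ℕ) → sumV f ≡ sum (tabulateᴸ f)
sumV-tabulate f = cong sum (map-tabulate id f)

sumV-suc : ∀ {n} (f : Fin (suc n) → ℕ) → sumV f ≡ f zero + sumV (f ∘ suc)
sumV-suc f = trans (sumV-tabulate f) (cong (f zero +_) (≡-sym (sumV-tabulate (f ∘ suc))))

sumV-zero : ∀ {n} → sumV {n} (λ _ → 0) ≡ 0
sumV-zero {zero} = refl
sumV-zero {suc n} = trans (sumV-suc {n} (λ _ → 0)) (sumV-zero {n})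

indicator≤ : ∀ {p} {P : Set p} {k} (P? : Dec P) → (P → 1 ≤ k) → 𝟙 (does P?) ≤ k
indicator≤ (yes p) 1≤k = 1≤k p
indicator≤ (no _)  _   = z≤n

sumV-mono : ∀ {n} {f h : Fin n → ℕ} → (∀ v → f v ≤ h v) → sumV f ≤ sumV h
sumV-mono {zero} _ = z≤n
sumV-mono {suc n} {f} {h} f≤h rewrite sumV-suc f | sumV-suc h =
  +-mono-≤ (f≤h zero) (sumV-mono (f≤h ∘ suc))

sumV-mono-< : ∀ {n} {f h : Fin n → ℕ} → (∀ v → f v ≤ h v) →
              (w : Fin n) → f w < h w → sumV f < sumV h
sumV-mono-< {suc n} {f} {h} f≤h w fw<hw rewrite sumV-suc f | sumV-suc h with w
... | zero  = +-mono-<-≤ fw<hw (sumV-mono (f≤h ∘ suc))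
... | suc w′ = +-mono-≤-< (f≤h zero) (sumV-mono-< (f≤h ∘ suc) w′ fw<hw)

sumV-+ : ∀ {n} (f h : Fin n → ℕ) → sumV (λ v → f v + h v) ≡ sumV f + sumV h
sumV-+ {zero} f h = refl
sumV-+ {suc n} f h
  rewrite sumV-suc (λ v → f v + h v) | sumV-suc f | sumV-suc h | sumV-+ (f ∘ suc) (h ∘ suc) =
  interchange (f zero) (h zero) (sumV (f ∘ suc)) (sumV (h ∘ suc))

sumV-single : ∀ {n} (w : Fin n) → sumV (λ v → 𝟙 (does (v ≟ w))) ≡ 1
sumV-single {suc n} zero = trans (sumV-suc {n} (λ v → 𝟙 (does (v ≟ zero)))) (cong suc (sumV-zero {n}))
sumV-single {suc n} (suc w) = trans (sumV-suc {n} (λ v → 𝟙 (does (v ≟ suc w)))) (sumV-single w)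

sumV-pos : ∀ {n} (f : Fin n → ℕ) → 0 < sumV f → ∃[ v ] 0 < f v
sumV-pos {zero} f ()
sumV-pos {suc n} f 0<Σ with f zero in f₀≡ | subst (0 <_) (sumV-suc f) 0<Σ
... | suc _ | _ = zero , subst (0 <_) (≡-sym f₀≡) (s≤s z≤n)
... | zero  | 0<Σ′ with sumV-pos (f ∘ suc) 0<Σ′
...   | v , 0<fv = suc v , 0<fv

sumV-two : ∀ {n} (f : Fin n → ℕ) → (∀ v → f v ≤ 1) → 2 ≤ sumV f →
           ∃₂ λ u₁ u₂ → u₁ ≢ u₂ × 0 < f u₁ × 0 < f u₂
sumV-two {zero} f _ ()
sumV-two {suc n} f f≤1 2≤Σ with f zero in f₀≡ | f≤1 zero | subst (2 ≤_) (sumV-suc f) 2≤Σ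
... | zero | _ | 2≤Σ′ with sumV-two (f ∘ suc) (f≤1 ∘ suc) 2≤Σ′
...   | u₁ , u₂ , u₁≢u₂ , p₁ , p₂ = suc u₁ , suc u₂ , u₁≢u₂ ∘ suc-injective , p₁ , p₂
sumV-two {suc n} f f≤1 2≤Σ | suc zero | _ | s≤s 1≤Σ′ with sumV-pos (f ∘ suc) 1≤Σ′
...   | v , p = zero , suc v , (λ ()) , subst (0 <_) (≡-sym f₀≡) (s≤s z≤n) , p
sumV-two {suc n} f f≤1 2≤Σ | suc (suc _) | s≤s () | _

select : ∀ {n p} {P : Pred (Fin n) p} → Decidable P → Subset n
select P? = tabulate (λ v → does (P? v))

∈-select⁻ : ∀ {n p} {P : Pred (Fin n) p} (P? : Decidable P) {x} → x ∈ select P? → P x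
∈-select⁻ P? {x} x∈ with P? x | trans (≡-sym (lookup∘tabulate _ x)) ([]=⇒lookup x∈)
... | yes px | _ = px
... | no _   | ()

∈-select⁺ : ∀ {n p} {P : Pred (Fin n) p} (P? : Decidable P) {x} → P x → x ∈ select P?
∈-select⁺ P? {x} px =
  lookup⇒[]= x _ (trans (lookup∘tabulate _ x) (dec-true (P? x) px))

∣select∣ : ∀ {n p} {P : Pred (Fin n) p} (P? : Decidable P) → ∣ select P? ∣ ≡ sumV (λ v → 𝟙 (does (P? v)))
∣select∣ {zero} P? = refl
∣select∣ {suc n} P? rewrite sumV-suc (λ v → 𝟙 (does (P? v))) with does (P? zero)
... | true  = cong suc (∣select∣ (P? ∘ suc))
... | false = ∣select∣ (P? ∘ suc)

adj⇒≢ : ∀ {n} (G : Graph n) {u v} → Adj G u v → u ≢ v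
adj⇒≢ G {u} uv refl = subst T (irrefl G u) uv

adj-sym : ∀ {n} (G : Graph n) {u v} → Adj G u v → Adj G v u
adj-sym G {u} {v} = subst T (sym G u v)

acyclic⇒noSquare : ∀ {n} (G : Graph n) {a b c d} → ¬ HasCycle G →
  Adj G a b → Adj G b c → Adj G c d → Adj G d a → a ≢ c → b ≢ d → ⊥
acyclic⇒noSquare G {a} {b} {c} {d} acyclic ab bc cd da a≢c b≢d =
  acyclic (_ , _ ∷ _ ∷ _ ∷ [] , _ , step ab (step bc (step cd stop)) , distinct , s≤s (s≤s z≤n) , da)
  where
  distinct : Unique (a ∷ b ∷ c ∷ d ∷ [])
  distinct = (adj⇒≢ G ab ∷ a≢c ∷ ≢-sym (adj⇒≢ G da) ∷ [])
           ∷ (adj⇒≢ G bc ∷ b≢d ∷ [])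
           ∷ (adj⇒≢ G cd ∷ [])
           ∷ [] ∷ []

connected⇒edge : ∀ {n} {G : Graph n} → Connected G → 2 ≤ n → ∃₂ λ u v → Adj G u v
connected⇒edge connected (s≤s (s≤s _)) with connected zero (suc zero)
... | _ , step {y = v} uv _ = zero , v , uv

nonPositive⇒0 : ∀ {m} → ¬ (0 < m) → m ≡ 0
nonPositive⇒0 = n≤0⇒n≡0 ∘ ≮⇒≥

ite-pos : ∀ {b m} → 0 < (if b then m else 0) → T b × 0 < m
ite-pos {true} 0<m = tt , 0<m

ite-≤ : ∀ b m → (if b then m else 0) ≤ m
ite-≤ true  m = ≤-refl
ite-≤ false m = z≤n

module Roman2 {n} (G : Graph n) {g : Fin n → ℕ} (rd : IsIndepRoman2DF G g) where

  -- The two defining properties of g used below.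
  private
    dominated : ∀ v → g v ≡ 0 → 2 ≤ nbrSum G g v
    dominated = proj₁ (proj₂ rd)

    independent : ∀ u v → 0 < g u → 0 < g v → ¬ Adj G u v
    independent = proj₂ (proj₂ rd)

  positiveNeighbour : ∀ v → g v ≡ 0 → ∃[ u ] (Adj G u v × 0 < g u)
  positiveNeighbour v gv≡0 with sumV-pos _ (≤-trans (s≤s z≤n) (dominated v gv≡0))
  ... | u , 0<term = u , ite-pos 0<term

  twoPositiveNeighbours : (∀ u → g u ≤ 1) → ∀ v → g v ≡ 0 →
    ∃₂ λ u₁ u₂ → u₁ ≢ u₂ × (Adj G u₁ v × 0 < g u₁) × (Adj G u₂ v × 0 < g u₂)
  twoPositiveNeighbours g≤1 v gv≡0
    with sumV-two _ (λ u → ≤-trans (ite-≤ (adj G u v) (g u)) (g≤1 u)) (dominated v gv≡0)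
  ... | u₁ , u₂ , u₁≢u₂ , p₁ , p₂ = u₁ , u₂ , u₁≢u₂ , ite-pos p₁ , ite-pos p₂

  -- In a connected graph of order ≥ 2, some vertex has value 0: an end of any edge.
  zeroVertex : Connected G → 2 ≤ n → ∃[ w ] g w ≡ 0
  zeroVertex connected 2≤n with connected⇒edge connected 2≤n
  ... | u , v , uv with 0 <? g u | 0 <? g v
  ...   | yes 0<gu | yes 0<gv = ⊥-elim (independent u v 0<gu 0<gv uv)
  ...   | no  gu≯0 | _        = u , nonPositive⇒0 gu≯0
  ...   | yes _    | no  gv≯0 = v , nonPositive⇒0 gv≯0

  positive? : Decidable (λ v → 0 < g v)
  positive? v = 0 <? g v

  support : Subset n
  support = select positive?

  support-indepDom : IndependentDominating G support
  support-indepDom = independent′ , dominating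
    where
    independent′ : Independent G support
    independent′ u v u∈ v∈ = independent u v (∈-select⁻ positive? u∈) (∈-select⁻ positive? v∈)

    dominating : Dominating G support
    dominating v v∉ with positiveNeighbour v (nonPositive⇒0 (v∉ ∘ ∈-select⁺ positive?))
    ... | u , uv , 0<gu = u , ∈-select⁺ positive? 0<gu , uv

  -- Each vertex counts once in the support but contributes g v ≥ 1 to the
  -- weight, so a vertex of value ≥ 2 makes the support strictly lighter.
  support-card : ∀ v → 2 ≤ g v → suc ∣ support ∣ ≤ weight g
  support-card v 2≤gv = begin-strict
    ∣ support ∣                           ≡⟨ ∣select∣ positive? ⟩
    sumV (λ u → 𝟙 (does (0 <? g u)))     <⟨ sumV-mono-< (λ u → counted≤ (g u)) v (counted< (g v) 2≤gv) ⟩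
    weight g                              ∎
    where
    open ≤-Reasoning
    counted≤ : ∀ m → 𝟙 (does (0 <? m)) ≤ m
    counted≤ zero    = z≤n
    counted≤ (suc m) = s≤s z≤n

    counted< : ∀ m → 2 ≤ m → 𝟙 (does (0 <? m)) < m
    counted< (suc zero)    (s≤s ())
    counted< (suc (suc m)) _        = s≤s (s≤s z≤n)

  module CaseB (acyclic : ¬ HasCycle G) (g≤1 : ∀ v → g v ≤ 1) (w : Fin n) (gw≡0 : g w ≡ 0) where

    InX : Pred (Fin n) 0ℓ
    InX v = v ≡ w ⊎ (0 < g v × ¬ Adj G w v)

    inX? : Decidable InX
    inX? v = (v ≟ w) ⊎-dec (positive? v ×-dec ¬? (T? (adj G w v)))

    X : Subset n
    X = select inX?

    X-independent : Independent G X
    X-independent u v u∈X v∈X with ∈-select⁻ inX? u∈X | ∈-select⁻ inX? v∈X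
    ... | inj₁ refl         | inj₁ refl         = λ ww → adj⇒≢ G ww refl
    ... | inj₁ refl         | inj₂ (_ , ¬wv)    = ¬wv
    ... | inj₂ (_ , ¬wu)    | inj₁ refl         = ¬wu ∘ adj-sym G
    ... | inj₂ (0<gu , _)   | inj₂ (0<gv , _)   = independent u v 0<gu 0<gv

    outside⇒0 : ∀ {x} → ¬ x ∈ X → ¬ Adj G w x → g x ≡ 0
    outside⇒0 x∉X ¬wx = nonPositive⇒0 (λ 0<gx → x∉X (∈-select⁺ inX? (inj₂ (0<gx , ¬wx))))

    -- Such a vertex x has positive neighbours u₁ ≠ u₂; one of them lies
    -- outside N(w), for otherwise w u₁ x u₂ is a 4-cycle.
    X-dominating : Dominating G X
    X-dominating x x∉X with T? (adj G w x)
    ... | yes wx = w , ∈-select⁺ inX? (inj₁ refl) , wx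
    ... | no ¬wx with twoPositiveNeighbours g≤1 x (outside⇒0 x∉X ¬wx)
    ...   | u₁ , u₂ , u₁≢u₂ , (u₁x , 0<gu₁) , (u₂x , 0<gu₂) with T? (adj G w u₁) | T? (adj G w u₂)
    ...     | no ¬wu₁ | _       = u₁ , ∈-select⁺ inX? (inj₂ (0<gu₁ , ¬wu₁)) , u₁x
    ...     | yes _   | no ¬wu₂ = u₂ , ∈-select⁺ inX? (inj₂ (0<gu₂ , ¬wu₂)) , u₂x
    ...     | yes wu₁ | yes wu₂ =
      ⊥-elim (acyclic⇒noSquare G acyclic wu₁ u₁x (adj-sym G u₂x) (adj-sym G wu₂) w≢x u₁≢u₂)
      where
      w≢x : w ≢ x
      w≢x w≡x = x∉X (∈-select⁺ inX? (inj₁ (≡-sym w≡x)))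

    inN outN : Fin n → ℕ
    inN  v = if adj G w v then g v else 0
    outN v = if adj G w v then 0 else g v

    outN-off : ∀ {v} → ¬ Adj G w v → outN v ≡ g v
    outN-off {v} ¬wv = cong (λ b → if b then 0 else g v) (dec-false (T? (adj G w v)) ¬wv)

    counted≤ : ∀ v → 𝟙 (does (inX? v)) ≤ 𝟙 (does (v ≟ w)) + outN v
    counted≤ v = indicator≤ (inX? v) λ
      { (inj₁ v≡w)           → ≤-trans (≤-reflexive (≡-sym (cong 𝟙 (dec-true (v ≟ w) v≡w))))
                                       (m≤m+n (𝟙 (does (v ≟ w))) (outN v))
      ; (inj₂ (0<gv , ¬wv)) → ≤-trans (≤-trans 0<gv (≤-reflexive (≡-sym (outN-off ¬wv))))
                                       (m≤n+m (outN v) (𝟙 (does (v ≟ w))))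
      }

    split≤ : ∀ v → inN v + outN v ≤ g v
    split≤ v with adj G w v
    ... | true  = ≤-reflexive (+-identityʳ (g v))
    ... | false = ≤-refl

    nbr-weight : 2 ≤ sumV inN
    nbr-weight = ≤-trans (dominated w gw≡0)
      (sumV-mono (λ u → ≤-reflexive (cong (λ b → if b then g u else 0) (sym G u w))))

    X-card : suc ∣ X ∣ ≤ weight g
    X-card = begin
      suc ∣ X ∣                                          ≡⟨ cong suc (∣select∣ inX?) ⟩
      suc (sumV (λ v → 𝟙 (does (inX? v))))              ≤⟨ s≤s (sumV-mono counted≤) ⟩
      suc (sumV (λ v → 𝟙 (does (v ≟ w)) + outN v))      ≡⟨ cong suc (sumV-+ (λ v → 𝟙 (does (v ≟ w))) outN) ⟩
      suc (sumV (λ v → 𝟙 (does (v ≟ w))) + sumV outN)   ≡⟨ cong (λ k → suc (k + sumV outN)) (sumV-single w) ⟩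
      2 + sumV outN                                      ≤⟨ +-mono-≤ nbr-weight ≤-refl ⟩
      sumV inN + sumV outN                               ≡⟨ sumV-+ inN outN ⟨
      sumV (λ v → inN v + outN v)                        ≤⟨ sumV-mono split≤ ⟩
      weight g                                           ∎
      where open ≤-Reasoning

  indepDomSet-below : IsTree G → 2 ≤ n → ∃[ X ] (IndependentDominating G X × suc ∣ X ∣ ≤ weight g)
  indepDomSet-below (connected , acyclic) 2≤n with any? (λ v → 2 ≤? g v)
  ... | yes (v , 2≤gv) = support , support-indepDom , support-card v 2≤gv
  ... | no noTwo with zeroVertex connected 2≤n
  ...   | w , gw≡0 = X , (X-independent , X-dominating) , X-card
    where
    g≤1 : ∀ v → g v ≤ 1
    g≤1 v = ≤-pred (≰⇒> (λ 2≤gv → noTwo (v , 2≤gv)))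

    open CaseB acyclic g≤1 w gw≡0

theorem14 : ∀ (n : ℕ) (T : Graph n) → 2 ≤ n → IsTree T →
    ∀ (a b : ℕ) → IsIndepDomNumber T a → IsIndepRoman2Number T b → a + 1 ≤ b
theorem14 n G 2≤n tree a b (_ , i-minimal) ((g , rd , weight≡b) , _)
  with Roman2.indepDomSet-below G rd tree 2≤n
... | X , X-indepDom , X<weight = begin
  a + 1      ≡⟨ +-comm a 1 ⟩
  suc a      ≤⟨ s≤s (i-minimal X X-indepDom) ⟩
  suc ∣ X ∣  ≤⟨ X<weight ⟩
  weight g   ≡⟨ weight≡b ⟩
  b          ∎
  where open ≤-Reasoning
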